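{- Let $G$ and $H$ be finite simple graphs and let $\{X_v\}_{v\in V(H)}$ be a minimal induced minor model of $H$ in $G$. Then for every $v\in V(H)$, the graph $G[X_v]$ contains no cycle of length greater than the degree of $v$ in $H$.
   Context: An induced minor model of $H$ in $G$ is a collection of pairwise disjoint sets $\{X_v\}_{v\in V(H)}$ with $X_v\subseteq V(G)$, each $G[X_v]$ connected, and such that for distinct $u,v$, some vertex of $X_u$ is adjacent in $G$ to some vertex of $X_v$ if and only if $uv\in E(H)$. Writing $H'=G[\bigcup_{v\in V(H)}X_v]$, the model is minimal if for every vertex $a\in V(H')$, the graph $H'\setminus a$ does not contain a graph isomorphic to $H$ as an induced minor (obtained by deleting vertices and contracting edges). -}

module Defs where

open import Data.Nat using (ℕ; zero; suc; _+_)
open import Data.Bool using (Bool; true; false; if_then_else_)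
open import Data.Fin using (Fin; zero; suc)
open import Data.Fin.Subset using (Subset; _∈_)
open import Data.Product using (Σ; ∃; ∃-syntax; _×_; _,_)
open import Data.Unit using (⊤)
open import Data.Empty using (⊥)
open import Relation.Binary.PropositionalEquality using (_≡_; _≢_)
open import Function.Bundles using (_⇔_)

record Graph : Set where
  field
    n      : ℕ
    adj    : Fin n → Fin n → Bool
    sym    : ∀ i j → adj i j ≡ adj j i
    irrefl : ∀ i → adj i i ≡ false

open Graph public

V : Graph → Set
V G = Fin (n G)

E : (G : Graph) → V G → V G → Set
E G x y = adj G x y ≡ true

count : ∀ {k} → (Fin k → Bool) → ℕ
count {zero}  p = 0
count {suc k} p = (if p zero then 1 else 0) + count (λ i → p (suc i))

deg : (H : Graph) → V H → ℕ
deg H v = count (λ u → adj H v u)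

data PathIn (G : Graph) (X : Subset (n G)) : V G → V G → Set where
  here : ∀ {x} → x ∈ X → PathIn G X x x
  step : ∀ {x y z} → x ∈ X → E G x y → PathIn G X y z → PathIn G X x z

Connected : (G : Graph) → Subset (n G) → Set
Connected G X = (∃[ x ] x ∈ X) × (∀ x y → x ∈ X → y ∈ X → PathIn G X x y)

Touch : (G : Graph) → Subset (n G) → Subset (n G) → Set
Touch G X Y = ∃[ x ] ∃[ y ] (x ∈ X × y ∈ Y × E G x y)

-- Induced minor model of H in the induced subgraph G[D], where the
-- vertex set D ⊆ V(G) is given as a predicate.  (Since G[D] is an
-- induced subgraph, adjacency/connectivity inside G[D] are those of G.)
record Model (G : Graph) (D : V G → Set) (H : Graph) : Set where
  field
    X      : V H → Subset (n G)
    inD    : ∀ v x → x ∈ X v → D x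
    conn   : ∀ v → Connected G (X v)
    disj   : ∀ u v → u ≢ v → ∀ x → x ∈ X u → x ∈ X v → ⊥
    adjIff : ∀ u v → u ≢ v → (Touch G (X u) (X v) ⇔ E H u v)

HasInducedMinor : (G : Graph) → (V G → Set) → Graph → Set
HasInducedMinor G D H = Model G D H

-- Vertex set of H' = G[⋃ X_v].
Union : ∀ {G D H} → Model G D H → V G → Set
Union {H = H} M x = ∃[ w ] (x ∈ Model.X M w)

Minimal : ∀ {G H} → Model G (λ _ → ⊤) H → Set
Minimal {G} {H} M =
  ∀ a → Union M a → ¬' (HasInducedMinor G (λ x → Union M x × x ≢ a) H)
  where
  ¬' : Set → Set
  ¬' A = A → ⊥

{-# OPTIONS --safe #-}
-- For a vertex a of the cycle C ⊆ X_v, call the branch of a the set of vertices of X_v that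
-- are a or cannot reach C − a inside G[X_v] − a; branches of distinct cycle vertices are
-- disjoint. A vertex x of the branch of a farthest from a does not disconnect G[X_v]: a
-- shortest walk from a to another vertex of the branch never passes through x, every other
-- vertex reaches C − a while avoiding x, and C − a is a path containing a neighbour of a.
-- Minimality forbids replacing X_v by X_v − x, so some neighbour u of v in H touches X_v only
-- at x. Disjointness of the branches makes a ↦ u injective, whence |C| ≤ deg v. The choices
-- along the way are classical, which is harmless as the conclusion is a decidable inequality.

module Submission where

open import Defs hiding (sym)
open import Data.Bool using (Bool; true; if_then_else_)
import Data.Bool.Properties as Bool
open import Data.Empty using (⊥; ⊥-elim)
open import Data.Fin using (Fin; zero; suc; inject₁; fromℕ)
import Data.Fin as Fin
open import Data.Fin.Properties
  using (_≟_; any?; ¬∀⟶∃¬; <-cmp; <⇒≢; ≤fromℕ; injective⇒≤; fromℕ<-injective)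
open import Data.Fin.Subset using (Subset; _∈_; _∉_; _-_; ⁅_⁆; _⊆_)
open import Data.Fin.Subset.Properties using (_∈?_; p─q⊆p; x∈p∧x≢y⇒x∈p-y)
open import Data.List using (List; filter; allFin)
open import Data.List.Extrema.Nat using (argmax; argmax-all; f[xs]≤f[argmax])
open import Data.List.Membership.Propositional.Properties using (∈-filter⁺; ∈-allFin)
import Data.List.Relation.Unary.All as All
open import Data.List.Relation.Unary.All.Properties using (all-filter)
open import Data.Nat using (ℕ; zero; suc; _≤_; _<_; _+_; z<s; z≤n; s≤s; s≤s⁻¹; _≤?_)
open import Data.Nat.Induction using (<-rec)
open import Data.Nat.Properties
  using (≮⇒≥; m<m+n; n≮n; ≤-<-trans; <-≤-trans; +-monoʳ-<; +-cancelˡ-≡; module ≤-Reasoning)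
import Data.Product as Product
open import Data.Product using (∃; ∃-syntax; ∃₂; _×_; _,_; proj₁; proj₂)
open import Data.Sum using (_⊎_; inj₁; inj₂)
open import Data.Unit using (⊤)
open import Data.Vec using (_∷_; there)
open import Effect.Monad using (RawMonad)
open import Function using (_∘_; id; const; case_of_)
open import Function.Bundles using (_⇔_; mk⇔; Equivalence)
open import Function.Definitions using (Injective)
import Level
open import Relation.Binary.Definitions using (tri<; tri≈; tri>)
open import Relation.Binary.PropositionalEquality
  using (_≡_; _≢_; refl; sym; trans; cong; ≢-sym)
open import Relation.Nullary using (¬_; Dec; yes; no)
open import Relation.Nullary.Decidable
  using (¬¬-excluded-middle; decidable-stable; ¬?; _×-dec_; _⊎-dec_; _→-dec_)
open import Relation.Nullary.Negation using (¬¬-Monad; ¬¬-map; contradiction)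

open RawMonad (¬¬-Monad {Level.zero}) using (pure; _>>=_)

¬¬-pull-Fin : ∀ {k} {P : Fin k → Set} → (∀ i → ¬ ¬ P i) → ¬ ¬ (∀ i → P i)
¬¬-pull-Fin {zero}  _ = pure λ ()
¬¬-pull-Fin {suc k} h = do
  p₀ ← h zero
  ps ← ¬¬-pull-Fin (h ∘ suc)
  pure λ { zero → p₀ ; (suc i) → ps i }

Least : (ℕ → Set) → ℕ → Set
Least A n = A n × (∀ {m} → A m → n ≤ m)

¬¬-least : ∀ {A : ℕ → Set} {n} → A n → ¬ ¬ ∃ (Least A)
¬¬-least {A} {n} = <-rec (λ n → A n → ¬ ¬ ∃ (Least A)) descend n
  where
  descend : ∀ n → (∀ {m} → m < n → A m → ¬ ¬ ∃ (Least A)) → A n → ¬ ¬ ∃ (Least A)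
  descend n below aₙ = ¬¬-excluded-middle {A = ∃[ m ] (m < n × A m)} >>= λ
    { (yes (m , m<n , aₘ)) → below m<n aₘ
    ; (no none)            → pure (n , aₙ , λ {m} aₘ → ≮⇒≥ (λ m<n → none (m , m<n , aₘ))) }

rank : ∀ {m} → (Fin m → Bool) → Fin m → ℕ
rank p zero    = 0
rank p (suc u) = (if p zero then 1 else 0) + rank (p ∘ suc) u

rank<count : ∀ {m} (p : Fin m → Bool) {u} → p u ≡ true → rank p u < count p
rank<count p {zero}  pu rewrite pu = z<s
rank<count p {suc u} pu = +-monoʳ-< (if p zero then 1 else 0) (rank<count (p ∘ suc) pu)

rank-injective : ∀ {m} (p : Fin m → Bool) {u w} → p u ≡ true → p w ≡ true →
                 rank p u ≡ rank p w → u ≡ w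
rank-injective p {zero}  {zero}  _  _  _ = refl
rank-injective p {zero}  {suc _} pu _  eq rewrite pu = case eq of λ ()
rank-injective p {suc _} {zero}  _  pw eq rewrite pw = case eq of λ ()
rank-injective p {suc u} {suc w} pu pw eq =
  cong suc (rank-injective (p ∘ suc) pu pw (+-cancelˡ-≡ (if p zero then 1 else 0) _ _ eq))

injection⇒≤count : ∀ {k m} (p : Fin m → Bool) (f : Fin k → Fin m) → Injective _≡_ _≡_ f →
                   (∀ i → p (f i) ≡ true) → k ≤ count p
injection⇒≤count p f f-injective pf = injective⇒≤ {f = position} position-injective
  where
  position : _ → Fin (count p)
  position i = Fin.fromℕ< (rank<count p (pf i))
  position-injective : Injective _≡_ _≡_ position
  position-injective eq =
    f-injective (rank-injective p (pf _) (pf _) (fromℕ<-injective _ _ _ _ eq))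

argmax-over : ∀ {k} {R : Fin k → Set} → (∀ i → Dec (R i)) → ∀ {i₀} → R i₀ → (f : Fin k → ℕ) →
              ∃[ i ] (R i × ∀ {j} → R j → f j ≤ f i)
argmax-over {k} R? {i₀} Ri₀ f =
  argmax f i₀ Rs , argmax-all f Ri₀ (all-filter R? (allFin k)) ,
  λ Rj → All.lookup (f[xs]≤f[argmax] i₀ Rs) (∈-filter⁺ R? (∈-allFin _) Rj)
  where
  Rs : List (Fin k)
  Rs = filter R? (allFin k)

x∉p-x : ∀ {n} (p : Subset n) x → x ∉ p - x
x∉p-x (_ ∷ _) zero    ()
x∉p-x (_ ∷ p) (suc x) (there x∈p-x) = x∉p-x p x x∈p-x

x∈p-y⇒x≢y : ∀ {n} {p : Subset n} {x y} → x ∈ p - y → x ≢ y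
x∈p-y⇒x≢y {p = p} x∈p-x refl = x∉p-x p _ x∈p-x

E-sym : ∀ G {x y} → E G x y → E G y x
E-sym G {x} {y} e = trans (Graph.sym G y x) e

E⇒≢ : ∀ G {x y} → E G x y → x ≢ y
E⇒≢ G {x} e refl = case trans (sym (irrefl G x)) e of λ ()

touch-sym : ∀ G {Y Z} → Touch G Y Z → Touch G Z Y
touch-sym G (y , z , y∈Y , z∈Z , e) = z , y , z∈Z , y∈Y , E-sym G e

touch-mono : ∀ G {Y Y′ Z Z′} → Y ⊆ Y′ → Z ⊆ Z′ → Touch G Y Z → Touch G Y′ Z′
touch-mono _ Y⊆Y′ Z⊆Z′ (y , z , y∈Y , z∈Z , e) = y , z , Y⊆Y′ y∈Y , Z⊆Z′ z∈Z , e

touch? : ∀ G Y Z → Dec (Touch G Y Z)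
touch? G Y Z = any? λ y → any? λ z → (y ∈? Y) ×-dec (z ∈? Z) ×-dec (adj G y z Bool.≟ true)

module Walks (G : Graph) where

  infixr 5 _∷⟨_⟩_ _⨾_
  infix  6 _⁻¹

  data Walk (P : V G → Set) : V G → V G → ℕ → Set where
    [_]    : ∀ {x} → P x → Walk P x x 0
    _∷⟨_⟩_ : ∀ {x y z l} → P x → E G x y → Walk P y z l → Walk P x z (suc l)

  Reach : (V G → Set) → V G → V G → Set
  Reach P x y = ∃[ l ] Walk P x y l

  _∖_ : (V G → Set) → V G → V G → Set
  (P ∖ x) u = P u × u ≢ x

  private variable
    P Q : V G → Set
    a b x y z : V G
    l l′ : ℕ

  source : Walk P x y l → P x
  source [ px ]        = px
  source (px ∷⟨ _ ⟩ _) = px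

  map : (∀ {u} → P u → Q u) → Walk P x y l → Walk Q x y l
  map f [ px ]        = [ f px ]
  map f (px ∷⟨ e ⟩ r) = f px ∷⟨ e ⟩ map f r

  weaken : (∀ {u} → P u → Q u) → Reach P x y → Reach Q x y
  weaken f = Product.map₂ (map f)

  _++_ : Walk P x y l → Walk P y z l′ → Walk P x z (l + l′)
  [ _ ]         ++ r′ = r′
  (px ∷⟨ e ⟩ r) ++ r′ = px ∷⟨ e ⟩ (r ++ r′)

  _⨾_ : Reach P x y → Reach P y z → Reach P x z
  (_ , r) ⨾ (_ , r′) = _ , r ++ r′

  reverse : Walk P x y l → Reach P y x
  reverse [ px ]        = _ , [ px ]
  reverse (px ∷⟨ e ⟩ r) = reverse r ⨾ (_ , source r ∷⟨ E-sym G e ⟩ [ px ])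

  _⁻¹ : Reach P x y → Reach P y x
  (_ , r) ⁻¹ = reverse r

  length-zero : Walk P x y 0 → x ≡ y
  length-zero [ _ ] = refl

  split-at : ∀ w → Walk P x y l →
             Walk (P ∖ w) x y l ⊎ ∃₂ λ l₁ l₂ → Walk P x w l₁ × Walk P w y l₂ × l₁ + l₂ ≡ l
  split-at {x = x} w r with x ≟ w
  split-at w r             | yes refl = inj₂ (0 , _ , [ source r ] , r , refl)
  split-at w [ px ]        | no x≢w   = inj₁ [ px , x≢w ]
  split-at w (px ∷⟨ e ⟩ r) | no x≢w with split-at w r
  ... | inj₁ r′                       = inj₁ ((px , x≢w) ∷⟨ e ⟩ r′)
  ... | inj₂ (l₁ , l₂ , r₁ , r₂ , eq) = inj₂ (suc l₁ , l₂ , px ∷⟨ e ⟩ r₁ , r₂ , cong suc eq)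

  first-hit : (C : V G → Set) → (∀ u → Dec (C u)) → Walk P x y l → C y →
              ∃[ w ] (C w × Reach (λ u → P u × (C u → u ≡ w)) x w)
  first-hit {x = x} C C? r Cy with C? x
  ... | yes Cx = x , Cx , _ , [ source r , const refl ]
  first-hit C C? [ px ]        Cy | no ¬Cx = contradiction Cy ¬Cx
  first-hit C C? (px ∷⟨ e ⟩ r) Cy | no ¬Cx with first-hit C C? r Cy
  ... | w , Cw , _ , r′ = w , Cw , _ , (px , ⊥-elim ∘ ¬Cx) ∷⟨ e ⟩ r′

  walk-of-path : ∀ {X} → PathIn G X x y → Reach (_∈ X) x y
  walk-of-path (here x∈X)     = _ , [ x∈X ]
  walk-of-path (step x∈X e p) = Product.map suc (x∈X ∷⟨ e ⟩_) (walk-of-path p)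

  path-of-walk : ∀ {X} → (∀ {u} → P u → u ∈ X) → Walk P x y l → PathIn G X x y
  path-of-walk f [ px ]        = here (f px)
  path-of-walk f (px ∷⟨ e ⟩ r) = step (f px) e (path-of-walk f r)

  hub⇒connected : ∀ {X} → (∀ {u} → P u → u ∈ X) → b ∈ X → (∀ {y} → y ∈ X → Reach P y b) →
                  Connected G X
  hub⇒connected P⊆X b∈X to-hub = (_ , b∈X) , λ _ _ y∈X z∈X →
    path-of-walk P⊆X (proj₂ (to-hub y∈X ⨾ to-hub z∈X ⁻¹))

  Shortest : (V G → Set) → V G → V G → ℕ → Set
  Shortest P x y = Least (Walk P x y)

  shortest-avoids-farther : ∀ {lx ly} → Shortest P a x lx → Shortest P a y ly → ly ≤ lx → y ≢ x →
                            Walk (P ∖ x) a y ly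
  shortest-avoids-farther {x = x} {lx = lx} {ly} (_ , x-least) (r , _) ly≤lx y≢x with split-at x r
  ... | inj₁ r′                          = r′
  ... | inj₂ (_ , zero , _ , r₂ , _)     = contradiction (sym (length-zero r₂)) y≢x
  ... | inj₂ (l₁ , suc l₂ , r₁ , _ , eq) = contradiction lx<lx (n≮n lx)
    where
    open ≤-Reasoning
    lx<lx : lx < lx
    lx<lx = begin-strict
      lx          ≤⟨ x-least r₁ ⟩
      l₁          <⟨ m<m+n l₁ z<s ⟩
      l₁ + suc l₂ ≡⟨ eq ⟩
      ly          ≤⟨ ly≤lx ⟩
      lx          ∎

  ¬¬-non-separating : ∀ {R : V G → Set} → (∀ u → Dec (R u)) → R a → (∀ {y} → R y → Reach P a y) →
                      ¬ ¬ (∃[ x ] (R x × ∀ {y} → R y → y ≢ x → Reach (P ∖ x) a y))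
  ¬¬-non-separating {a = a} {P = P} {R} R? Ra reach =
    ¬¬-map farthest (¬¬-pull-Fin (distance-if ∘ R?))
    where
    distance-if : ∀ {y} → Dec (R y) → ¬ ¬ (∃[ l ] (R y → Shortest P a y l))
    distance-if (yes Ry) = ¬¬-map (Product.map₂ const) (¬¬-least (proj₂ (reach Ry)))
    distance-if (no ¬Ry) = pure (0 , λ Ry → contradiction Ry ¬Ry)

    farthest : (∀ y → ∃[ l ] (R y → Shortest P a y l)) →
               ∃[ x ] (R x × ∀ {y} → R y → y ≢ x → Reach (P ∖ x) a y)
    farthest dist with argmax-over R? Ra (proj₁ ∘ dist)
    ... | x , Rx , x-farthest = x , Rx , λ {y} Ry y≢x →
      _ , shortest-avoids-farther (proj₂ (dist x) Rx) (proj₂ (dist y) Ry) (x-farthest Ry) y≢x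

  Chain : ∀ {k} → (Fin (suc k) → V G) → Set
  Chain {k} f = ∀ (i : Fin k) → E G (f (inject₁ i)) (f (suc i))

  chain-walk : ∀ {k} (f : Fin (suc k) → V G) → Chain f → ∀ {s t} → s Fin.≤ t →
               (∀ r → s Fin.≤ r → r Fin.≤ t → P (f r)) → Reach P (f s) (f t)
  chain-walk f ch {zero} {zero} _ Pf = _ , [ Pf zero z≤n z≤n ]
  chain-walk {k = suc _} f ch {zero} {suc t} _ Pf =
    Product.map suc (Pf zero z≤n z≤n ∷⟨ ch zero ⟩_)
      (chain-walk (f ∘ suc) (ch ∘ suc) {zero} {t} z≤n (λ r _ r≤t → Pf (suc r) z≤n (s≤s r≤t)))
  chain-walk {k = suc _} f ch {suc s} {suc t} s≤t Pf =
    chain-walk (f ∘ suc) (ch ∘ suc) (s≤s⁻¹ s≤t) (λ r s≤r r≤t → Pf (suc r) (s≤s s≤r) (s≤s r≤t))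

record Cycle (G : Graph) (k : ℕ) : Set where
  field
    vertex    : Fin (suc k) → V G
    injective : Injective _≡_ _≡_ vertex
    chain     : Walks.Chain G vertex
    closing   : E G (vertex (fromℕ k)) (vertex zero)

module _ {G : Graph} {k} (C : Cycle G k) where
  open Walks G
  open Cycle C renaming (vertex to c)

  OnCycle : V G → Set
  OnCycle u = ∃[ j ] c j ≡ u

  on-cycle? : ∀ u → Dec (OnCycle u)
  on-cycle? u = any? λ j → c j ≟ u

  cycle-neighbour : ∀ i → ∃[ j ] E G (c i) (c j)
  cycle-neighbour zero    = fromℕ k , E-sym G closing
  cycle-neighbour (suc i) = inject₁ i , E-sym G (chain i)

  private
    on-cycle-minus : ∀ {i} r → r ≢ i → (OnCycle ∖ c i) (c r)
    on-cycle-minus _ r≢i = (_ , refl) , r≢i ∘ injective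

    from-zero : ∀ {i r} → r Fin.< i → Reach (OnCycle ∖ c i) (c zero) (c r)
    from-zero r<i = chain-walk c chain z≤n λ q _ q≤r →
      on-cycle-minus q (<⇒≢ (≤-<-trans q≤r r<i))

    to-last : ∀ {i r} → i Fin.< r → Reach (OnCycle ∖ c i) (c r) (c (fromℕ k))
    to-last {r = r} i<r = chain-walk c chain (≤fromℕ r) λ q r≤q _ →
      on-cycle-minus q (≢-sym (<⇒≢ (<-≤-trans i<r r≤q)))

    across : ∀ {i r r′ : Fin (suc k)} → r Fin.< i → i Fin.< r′ →
             Reach (OnCycle ∖ c i) (c zero) (c (fromℕ k))
    across {r′ = r′} r<i i<r′ =
      _ , on-cycle-minus zero (<⇒≢ (≤-<-trans z≤n r<i)) ∷⟨ E-sym G closing ⟩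
          [ on-cycle-minus (fromℕ k) (≢-sym (<⇒≢ (<-≤-trans i<r′ (≤fromℕ r′)))) ]

  cycle-minus-vertex-connected : ∀ {i j j′} → j ≢ i → j′ ≢ i → Reach (OnCycle ∖ c i) (c j) (c j′)
  cycle-minus-vertex-connected {i} {j} {j′} j≢i j′≢i with <-cmp j i | <-cmp j′ i
  ... | tri< j<i _ _ | tri< j′<i _ _ = from-zero j<i ⁻¹ ⨾ from-zero j′<i
  ... | tri> _ _ i<j | tri> _ _ i<j′ = to-last i<j ⨾ to-last i<j′ ⁻¹
  ... | tri< j<i _ _ | tri> _ _ i<j′ = from-zero j<i ⁻¹ ⨾ across {i} {j} j<i i<j′ ⨾ to-last i<j′ ⁻¹
  ... | tri> _ _ i<j | tri< j′<i _ _ = to-last i<j ⨾ across {i} {j′} j′<i i<j ⁻¹ ⨾ from-zero j′<i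
  ... | tri≈ _ j≡i _ | _             = contradiction j≡i j≢i
  ... | _            | tri≈ _ j′≡i _ = contradiction j′≡i j′≢i

module Branches {G : Graph} {X : Subset (n G)} (X-connected : Connected G X)
                {k} (C : Cycle G k) (C⊆X : ∀ i → Cycle.vertex C i ∈ X) where
  open Walks G
  open Cycle C renaming (vertex to c)

  private variable
    i j : Fin (suc k)
    u w x y : V G

  InX : V G → Set
  InX = _∈ X

  Escapes : Fin (suc k) → V G → Set
  Escapes i y = ∃[ w ] ((OnCycle C ∖ c i) w × Reach (InX ∖ c i) y w)

  Branch : Fin (suc k) → V G → Set
  Branch i y = y ∈ X × (y ≡ c i ⊎ ¬ Escapes i y)

  branch? : (∀ y → Dec (Escapes i y)) → ∀ y → Dec (Branch i y)
  branch? {i} escapes? y = (y ∈? X) ×-dec ((y ≟ c i) ⊎-dec ¬? (escapes? y))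

  private
    reach-in-X : x ∈ X → y ∈ X → Reach InX x y
    reach-in-X x∈X y∈X = walk-of-path (proj₂ X-connected _ _ x∈X y∈X)

    cycle-escapes : (OnCycle C ∖ c i) y → Escapes i y
    cycle-escapes {y = y} Cy@((j , refl) , y≢cᵢ) = y , Cy , _ , [ C⊆X j , y≢cᵢ ]

    first-hit-escapes : (OnCycle C ∖ c i) w → Reach (λ u → InX u × (OnCycle C u → u ≡ w)) y w →
                        Escapes i y
    first-hit-escapes {i = i} Cw r = _ , Cw , weaken avoid r
      where
      avoid : InX u × (OnCycle C u → u ≡ _) → (InX ∖ c i) u
      avoid (u∈X , only-w) = u∈X , λ { refl → proj₂ Cw (sym (only-w (i , refl))) }

  branches-disjoint : c i ≢ c j → Branch i y → Branch j y → ⊥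
  branches-disjoint cᵢ≢cⱼ (_ , inj₁ refl) (_ , inj₁ cᵢ≡cⱼ) = cᵢ≢cⱼ cᵢ≡cⱼ
  branches-disjoint cᵢ≢cⱼ (_ , inj₁ refl) (_ , inj₂ ¬escⱼ) =
    ¬escⱼ (cycle-escapes ((_ , refl) , cᵢ≢cⱼ))
  branches-disjoint cᵢ≢cⱼ (_ , inj₂ ¬escᵢ) (_ , inj₁ refl) =
    ¬escᵢ (cycle-escapes ((_ , refl) , cᵢ≢cⱼ ∘ sym))
  branches-disjoint {i = i} cᵢ≢cⱼ (y∈X , inj₂ ¬escᵢ) (_ , inj₂ ¬escⱼ)
    with first-hit (OnCycle C) (on-cycle? C) (proj₂ (reach-in-X y∈X (C⊆X i))) (i , refl)
  ... | w , Cw , r with w ≟ c i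
  ...   | yes refl = ¬escⱼ (first-hit-escapes (Cw , cᵢ≢cⱼ) r)
  ...   | no  w≢cᵢ = ¬escᵢ (first-hit-escapes (Cw , w≢cᵢ) r)

  branch-unique : Branch i y → Branch j y → i ≡ j
  branch-unique {i = i} {j = j} Bᵢ Bⱼ with i ≟ j
  ... | yes i≡j = i≡j
  ... | no  i≢j = ⊥-elim (branches-disjoint (i≢j ∘ injective) Bᵢ Bⱼ)

  private
    ∈X-x⁻ : y ∈ X - x → (InX ∖ x) y
    ∈X-x⁻ {x = x} y∈X-x = p─q⊆p X ⁅ x ⁆ y∈X-x , x∈p-y⇒x≢y y∈X-x

    ∈X-x⁺ : (InX ∖ x) y → y ∈ X - x
    ∈X-x⁺ (y∈X , y≢x) = x∈p∧x≢y⇒x∈p-y y∈X y≢x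

  cycle-avoids-branch : Branch i x → (OnCycle C ∖ c i) u → (InX ∖ x) u
  cycle-avoids-branch Bx Cu@((j , refl) , _) = C⊆X j , off Bx Cu
    where
    off : Branch i x → (OnCycle C ∖ c i) u → u ≢ x
    off (_ , inj₁ refl) (_ , u≢x) = u≢x
    off (_ , inj₂ ¬esc) Cu refl   = ¬esc (cycle-escapes Cu)

  escape-avoids-branch : Branch i x → (OnCycle C ∖ c i) w → Reach (InX ∖ c i) y w →
                         Reach (InX ∖ x) y w
  escape-avoids-branch (_ , inj₁ refl) _ r = r
  escape-avoids-branch {x = x} (_ , inj₂ ¬esc) Cw (_ , r) with split-at x r
  ... | inj₁ r′                   = weaken (Product.map₁ proj₁) (_ , r′)
  ... | inj₂ (_ , _ , _ , r₂ , _) = contradiction (_ , Cw , _ , r₂) ¬esc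

  ¬¬-non-separating-branch-vertex : ∀ i → ¬ ¬ (∃[ x ] (Branch i x × Connected G (X - x)))
  ¬¬-non-separating-branch-vertex i = do
    escapes? ← ¬¬-pull-Fin (λ _ → ¬¬-excluded-middle)
    (x , Bx , spares-branch) ←
      ¬¬-non-separating (branch? escapes?) (C⊆X i , inj₁ refl) (reach-in-X (C⊆X i) ∘ proj₁)
    pure (x , Bx , hub⇒connected ∈X-x⁺ (∈X-x⁺ (cycle-avoids-branch Bx Cb))
                     (λ y∈X-x → to-b Bx spares-branch (∈X-x⁻ y∈X-x) (escapes? _)))
    where
    b : Fin (suc k)
    b = proj₁ (cycle-neighbour C i)
    cᵢ-cb : E G (c i) (c b)
    cᵢ-cb = proj₂ (cycle-neighbour C i)
    Cb : (OnCycle C ∖ c i) (c b)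
    Cb = (b , refl) , ≢-sym (E⇒≢ G cᵢ-cb)
    to-b : Branch i x → (∀ {y} → Branch i y → y ≢ x → Reach (InX ∖ x) (c i) y) →
           (InX ∖ x) y → Dec (Escapes i y) → Reach (InX ∖ x) y (c b)
    to-b Bx _ _ (yes (_ , Cw@((j , refl) , cⱼ≢cᵢ) , r)) =
      escape-avoids-branch Bx Cw r ⨾
      weaken (cycle-avoids-branch Bx)
        (cycle-minus-vertex-connected C (cⱼ≢cᵢ ∘ cong c) (proj₂ Cb ∘ cong c))
    to-b {x = x} {y = y} Bx spares-branch (y∈X , y≢x) (no ¬esc) =
      r ⁻¹ ⨾ (_ , source (proj₂ r) ∷⟨ cᵢ-cb ⟩ [ cycle-avoids-branch Bx Cb ])
      where
      r : Reach (InX ∖ x) (c i) y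
      r = spares-branch (y∈X , inj₂ ¬esc) y≢x

module _ {G H : Graph} (M : Model G (λ _ → ⊤) H) where
  open Model M

  Private : V H → V G → V H → Set
  Private v x u = E H v u × ¬ Touch G (X v - x) (X u)

  model-without : ∀ {v x} → x ∈ X v → Connected G (X v - x) →
                  (∀ u → E H v u → Touch G (X v - x) (X u)) →
                  HasInducedMinor G (λ z → Union M z × z ≢ x) H
  model-without {v} {x} x∈Xᵥ Xᵥ-x-connected touches = record
    { X = X′ ; inD = inD′ ; conn = conn′ ; disj = disj′ ; adjIff = adjIff′ }
    where
    X′ : V H → Subset (n G)
    X′ w with w ≟ v
    ... | yes _ = X v - x
    ... | no  _ = X w

    X′⊆X : ∀ w → X′ w ⊆ X w
    X′⊆X w with w ≟ v
    ... | yes refl = p─q⊆p (X v) ⁅ x ⁆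
    ... | no  _    = id

    x∉X′ : ∀ w {z} → z ∈ X′ w → z ≢ x
    x∉X′ w with w ≟ v
    ... | yes refl = x∈p-y⇒x≢y
    ... | no  w≢v  = λ { z∈Xw refl → disj w v w≢v _ z∈Xw x∈Xᵥ }

    inD′ : ∀ w z → z ∈ X′ w → Union M z × z ≢ x
    inD′ w z z∈X′w = (w , X′⊆X w z∈X′w) , x∉X′ w z∈X′w

    conn′ : ∀ w → Connected G (X′ w)
    conn′ w with w ≟ v
    ... | yes refl = Xᵥ-x-connected
    ... | no  _    = conn w

    disj′ : ∀ u w → u ≢ w → ∀ z → z ∈ X′ u → z ∈ X′ w → ⊥
    disj′ u w u≢w z z∈X′u z∈X′w = disj u w u≢w z (X′⊆X u z∈X′u) (X′⊆X w z∈X′w)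

    touch′ : ∀ u w → u ≢ w → E H u w → Touch G (X′ u) (X′ w)
    touch′ u w u≢w e with u ≟ v | w ≟ v
    ... | yes refl | yes refl = contradiction refl u≢w
    ... | yes refl | no  _    = touches w e
    ... | no  _    | yes refl = touch-sym G (touches u (E-sym H e))
    ... | no  _    | no  _    = Equivalence.from (adjIff u w u≢w) e

    adjIff′ : ∀ u w → u ≢ w → (Touch G (X′ u) (X′ w) ⇔ E H u w)
    adjIff′ u w u≢w =
      mk⇔ (Equivalence.to (adjIff u w u≢w) ∘ touch-mono G (X′⊆X u) (X′⊆X w)) (touch′ u w u≢w)

  private-neighbour : Minimal M → ∀ {v x} → x ∈ X v → Connected G (X v - x) → ∃ (Private v x)
  private-neighbour minimal {v} {x} x∈Xᵥ Xᵥ-x-connected =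
    Product.map₂ (λ {u} → counterexample (adj H v u Bool.≟ true))
      (¬∀⟶∃¬ (n H) _ (λ u → (adj H v u Bool.≟ true) →-dec touch? G (X v - x) (X u))
        (minimal x (v , x∈Xᵥ) ∘ model-without x∈Xᵥ Xᵥ-x-connected))
    where
    counterexample : ∀ {A B : Set} → Dec A → ¬ (A → B) → A × ¬ B
    counterexample (yes a) ¬[a⇒b] = a , ¬[a⇒b] ∘ const
    counterexample (no ¬a) ¬[a⇒b] = contradiction (⊥-elim ∘ ¬a) ¬[a⇒b]

  private-unique : ∀ {v x x′ u} → Private v x u → Private v x′ u → x ≡ x′
  private-unique {v} {x} {x′} {u} (e , ¬touch) (_ , ¬touch′)
    with t , s , t∈Xᵥ , s∈Xᵤ , t-s ← Equivalence.from (adjIff v u (E⇒≢ H e)) e =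
    trans (sym (only-contact ¬touch)) (only-contact ¬touch′)
    where
    only-contact : ∀ {y} → ¬ Touch G (X v - y) (X u) → t ≡ y
    only-contact {y} ¬touch = decidable-stable (t ≟ y)
      (λ t≢y → ¬touch (t , s , x∈p∧x≢y⇒x∈p-y t∈Xᵥ t≢y , s∈Xᵤ , t-s))

lemma4p1 : (G H : Graph) (M : Model G (λ _ → ⊤) H) → Minimal M →
    (v : V H) (m : ℕ) (c : Fin (suc (suc (suc m))) → V G) →
    Injective _≡_ _≡_ c →
    (∀ i → c i ∈ Model.X M v) →
    (∀ (i : Fin (suc (suc m))) → E G (c (inject₁ i)) (c (suc i))) →
    E G (c (fromℕ (suc (suc m)))) (c zero) →
    suc (suc (suc m)) ≤ deg H v
lemma4p1 G H M minimal v m c c-injective c∈Xᵥ chain closing =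
  decidable-stable (_ ≤? deg H v) (¬¬-map count-neighbours (¬¬-pull-Fin private-branch-vertex))
  where
  open Model M

  cycle : Cycle G (suc (suc m))
  cycle = record { vertex = c ; injective = c-injective ; chain = chain ; closing = closing }

  open Branches (conn v) cycle c∈Xᵥ

  PrivateBranchVertex : Fin (suc (suc (suc m))) → Set
  PrivateBranchVertex i = ∃[ x ] (Branch i x × ∃ (Private M v x))

  private-branch-vertex : ∀ i → ¬ ¬ PrivateBranchVertex i
  private-branch-vertex i = ¬¬-map
    (λ (x , Bx , Xᵥ-x-connected) → x , Bx , private-neighbour M minimal (proj₁ Bx) Xᵥ-x-connected)
    (¬¬-non-separating-branch-vertex i)

  count-neighbours : (∀ i → PrivateBranchVertex i) → suc (suc (suc m)) ≤ deg H v
  count-neighbours choice = injection⇒≤count (adj H v) neighbour neighbour-injective adjacent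
    where
    neighbour : Fin (suc (suc (suc m))) → V H
    neighbour i = proj₁ (proj₂ (proj₂ (choice i)))

    adjacent : ∀ i → E H v (neighbour i)
    adjacent i = proj₁ (proj₂ (proj₂ (proj₂ (choice i))))

    neighbour-injective : Injective _≡_ _≡_ neighbour
    neighbour-injective {i} {j} uᵢ≡uⱼ with choice i | choice j
    ... | _ , Bx , _ , p | _ , Bx′ , _ , p′
      with refl ← uᵢ≡uⱼ
      with refl ← private-unique M p p′ = branch-unique Bx Bx′
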